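{- Let $F$ be the field of odd prime order $p\equiv 1\pmod 8$, let $i\in F$ satisfy $i^2=-1$, let $S^*$ be the set of nonzero squares in $F$, and let $\mathcal{T}=\{x\in F\setminus\{0\}: 1+x^2\in S^*\}$. Then for each $x\in F\setminus\{0\}$, at least one of the three elements $x$, $ix$, $ix^2$ belongs to $\mathcal{T}$. -}

module Defs where

open import Data.Nat using (ℕ; zero; suc; _+_; _*_; _∸_; NonZero)
open import Data.Nat.DivMod using (_mod_)
open import Data.Fin using (Fin; toℕ)
open import Data.Product using (∃; _×_)
open import Relation.Binary.PropositionalEquality using (_≡_; _≢_)

module PrimeField (p : ℕ) .{{_ : NonZero p}} where

  F : Set
  F = Fin p

  0F : F
  0F = 0 mod p

  1F : F
  1F = 1 mod p

  _+F_ : F → F → F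
  a +F b = (toℕ a + toℕ b) mod p

  _*F_ : F → F → F
  a *F b = (toℕ a * toℕ b) mod p

  -- additive inverse: -a = (p - a) mod p  (gives 0 for a = 0)
  -F_ : F → F
  -F a = (p ∸ toℕ a) mod p

  NonzeroSquare : F → Set
  NonzeroSquare a = (a ≢ 0F) × ∃ λ y → y *F y ≡ a

  InT : F → Set
  InT x = (x ≢ 0F) × NonzeroSquare (1F +F (x *F x))

-- Write q = x². As i² = -1, 1 + (ix)² = 1 - q and 1 + (ix²)² = 1 - q² = (1 + q)(1 - q).
-- If one of 1 ± q vanishes, the other is 2, a nonzero square; if neither vanishes and neither
-- is a square, their product is a nonzero square. Both facts come from Euler's criterion
-- a^((p-1)/2) = -1 for non-squares a: pairing each y ∈ F* with a/y gives ∏ F* = a^((p-1)/2),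
-- and pairing y with 1/y gives Wilson's ∏ F* = -1. Since 8 ∣ p - 1, i^((p-1)/2) = (i⁴)^((p-1)/8) = 1,
-- so i = c² is a square, and then 2 = (ic(1 + i))².
module Submission where

open import Defs
open import Algebra.Bundles using (CommutativeRing)
open import Algebra.Structures using (IsCommutativeRing)
open import Data.Empty using (⊥-elim)
open import Data.Fin as Fin using (toℕ)
open import Data.Fin.Properties using (toℕ-fromℕ<; toℕ-injective; toℕ<n)
open import Data.List using (List; []; _∷_; length; filter; foldr; allFin)
open import Data.List.Membership.Propositional using (_∈_)
open import Data.List.Membership.Propositional.Properties using (∈-filter⁺; ∈-filter⁻; ∈-allFin)
open import Data.List.Properties using (filter-all; filter-accept; filter-reject; length-tabulate)
open import Data.List.Relation.Unary.All as All using (All)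
open import Data.List.Relation.Unary.AllPairs using (_∷_)
open import Data.List.Relation.Unary.Any as Any using (here; there)
open import Data.List.Relation.Unary.Unique.Propositional using (Unique)
open import Data.List.Relation.Unary.Unique.Propositional.Properties using (filter⁺; allFin⁺)
open import Data.Nat as ℕ using (ℕ; zero; suc; _≤_; s≤s; _∸_; NonZero)
open import Data.Nat.Coprimality using (prime⇒coprime; coprime-Bézout)
open import Data.Nat.Divisibility using (_∣_; divides)
open import Data.Nat.DivMod
  using (_mod_; _%_; _/_; m≡m%n+[m/n]*n; %-distribˡ-+; %-distribˡ-*; [m+kn]%n≡m%n; [m+n]%n≡m%n; m<n⇒m%n≡m)
open import Data.Nat.GCD using (module Bézout)
open import Data.Nat.Primality using (Prime; prime⇒nonTrivial)
open import Data.Nat.Properties as ℕ using (suc-injective)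
open import Data.Product using (∃; _×_; _,_; proj₁; proj₂)
open import Data.Sum as Sum using (_⊎_; inj₁; inj₂; [_,_]′)
open import Function using (_∘_; id; case_of_)
open import Relation.Binary.Definitions using (DecidableEquality)
open import Relation.Binary.PropositionalEquality
  using (_≡_; _≢_; refl; sym; trans; cong; cong₂; subst; isEquivalence; module ≡-Reasoning)
open import Relation.Nullary using (¬_; Dec; yes; no)
open import Relation.Nullary.Decidable using (¬?)

module Field
  {F : Set} {add mul : F → F → F} {neg : F → F} {0# 1# : F}
  (isCommutativeRing : IsCommutativeRing _≡_ add mul neg 0# 1#)
  (_≟_ : DecidableEquality F)
  (inverse : ∀ {x} → x ≢ 0# → ∃ λ y → mul x y ≡ 1#)
  (1≢-1 : 1# ≢ neg 1#)
  where

  infixl 6 _+_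
  infixl 7 _*_
  infix 8 -_

  _+_ _*_ : F → F → F
  _+_ = add
  _*_ = mul

  -_ : F → F
  -_ = neg

  commutativeRing : CommutativeRing _ _
  commutativeRing = record { isCommutativeRing = isCommutativeRing }

  open CommutativeRing commutativeRing
    using ( +-assoc; +-comm; +-identityˡ; -‿inverseʳ; *-assoc; *-comm; *-identityˡ; *-identityʳ
          ; distribˡ; distribʳ; zeroˡ; zeroʳ; ring; semiring)
  open import Algebra.Properties.Ring ring
    using ( -1*x≈-x; -‿distribˡ-*; -‿injective; -‿involutive; -0#≈0#; -‿+-comm; +-inverseʳ-unique
          ; x[y-z]≈xy-xz; x∙y⁻¹≈ε⇒x≈y)
  open import Algebra.Properties.Semiring.Exp semiring using (_^_; ^-homo-*; ^-assocʳ)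
  open import Algebra.Properties.CommutativeSemiring.Exp
    (CommutativeRing.commutativeSemiring commutativeRing) using (^-distrib-*)
  open import Algebra.Properties.CommutativeSemigroup
    (CommutativeRing.*-commutativeSemigroup commutativeRing) using (xy∙z≈y∙xz; x∙yz≈y∙xz; interchange)
  open import Algebra.Properties.CommutativeSemigroup
    (CommutativeRing.+-commutativeSemigroup commutativeRing) using () renaming (interchange to +-interchange)

  1≢0 : 1# ≢ 0#
  1≢0 1≡0 = 1≢-1 (trans 1≡0 (trans (sym -0#≈0#) (cong -_ (sym 1≡0))))

  -1≢0 : - 1# ≢ 0#
  -1≢0 -1≡0 = 1≢0 (trans (sym (-‿involutive 1#)) (trans (cong -_ -1≡0) -0#≈0#))

  -1*-1≡1 : - 1# * - 1# ≡ 1#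
  -1*-1≡1 = trans (-1*x≈-x (- 1#)) (-‿involutive 1#)

  x*y≡1⇒y≢0 : ∀ {x y} → x * y ≡ 1# → y ≢ 0#
  x*y≡1⇒y≢0 {x} xy≡1 refl = 1≢0 (trans (sym xy≡1) (zeroʳ x))

  1#^n≡1 : ∀ n → 1# ^ n ≡ 1#
  1#^n≡1 zero    = refl
  1#^n≡1 (suc n) = trans (*-identityˡ _) (1#^n≡1 n)

  x+y≡0⇒y≡-x : ∀ {x y} → x + y ≡ 0# → y ≡ - x
  x+y≡0⇒y≡-x = +-inverseʳ-unique _ _

  [x+y][x-y]≡xx-yy : ∀ x y → (x + y) * (x + - y) ≡ x * x + - (y * y)
  [x+y][x-y]≡xx-yy x y = begin
    (x + y) * (x + - y)                      ≡⟨ x[y-z]≈xy-xz (x + y) x y ⟩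
    (x + y) * x + - ((x + y) * y)            ≡⟨ cong₂ (λ a b → a + - b) (distribʳ x x y) (distribʳ y x y) ⟩
    (x * x + y * x) + - (x * y + y * y)      ≡⟨ cong (λ a → (x * x + a) + - (x * y + y * y)) (*-comm y x) ⟩
    (x * x + x * y) + - (x * y + y * y)      ≡⟨ cong ((x * x + x * y) +_) (sym (-‿+-comm (x * y) (y * y))) ⟩
    (x * x + x * y) + (- (x * y) + - (y * y)) ≡⟨ +-assoc (x * x) (x * y) _ ⟩
    x * x + (x * y + (- (x * y) + - (y * y))) ≡⟨ cong (x * x +_) (sym (+-assoc (x * y) _ _)) ⟩
    x * x + ((x * y + - (x * y)) + - (y * y)) ≡⟨ cong (λ a → x * x + (a + - (y * y))) (-‿inverseʳ (x * y)) ⟩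
    x * x + (0# + - (y * y))                 ≡⟨ cong (x * x +_) (+-identityˡ _) ⟩
    x * x + - (y * y)                        ∎
    where open ≡-Reasoning

  *-cancelˡ : ∀ {x y z} → x ≢ 0# → x * y ≡ x * z → y ≡ z
  *-cancelˡ {x} {y} {z} x≢0 xy≡xz = begin
    y              ≡⟨ sym (*-identityˡ y) ⟩
    1# * y         ≡⟨ cong (_* y) (sym xx′≡1) ⟩
    x * x′ * y     ≡⟨ xy∙z≈y∙xz x x′ y ⟩
    x′ * (x * y)   ≡⟨ cong (x′ *_) xy≡xz ⟩
    x′ * (x * z)   ≡⟨ sym (xy∙z≈y∙xz x x′ z) ⟩
    x * x′ * z     ≡⟨ cong (_* z) xx′≡1 ⟩
    1# * z         ≡⟨ *-identityˡ z ⟩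
    z              ∎
    where
    open ≡-Reasoning
    x′ = proj₁ (inverse x≢0)
    xx′≡1 = proj₂ (inverse x≢0)

  x*y≡0⇒x≡0∨y≡0 : ∀ {x y} → x * y ≡ 0# → x ≡ 0# ⊎ y ≡ 0#
  x*y≡0⇒x≡0∨y≡0 {x} xy≡0 with x ≟ 0#
  ... | yes x≡0 = inj₁ x≡0
  ... | no x≢0  = inj₂ (*-cancelˡ x≢0 (trans xy≡0 (sym (zeroʳ x))))

  x≢0∧y≢0⇒x*y≢0 : ∀ {x y} → x ≢ 0# → y ≢ 0# → x * y ≢ 0#
  x≢0∧y≢0⇒x*y≢0 x≢0 y≢0 = [ x≢0 , y≢0 ]′ ∘ x*y≡0⇒x≡0∨y≡0

  x*x≡1⇒x≡1∨x≡-1 : ∀ {x} → x * x ≡ 1# → x ≡ 1# ⊎ x ≡ - 1#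
  x*x≡1⇒x≡1∨x≡-1 {x} xx≡1 =
    Sum.swap (Sum.map x+1≡0⇒x≡-1 (x∙y⁻¹≈ε⇒x≈y x 1#) (x*y≡0⇒x≡0∨y≡0 [x+1][x-1]≡0))
    where
    open ≡-Reasoning
    x+1≡0⇒x≡-1 : x + 1# ≡ 0# → x ≡ - 1#
    x+1≡0⇒x≡-1 = x+y≡0⇒y≡-x ∘ trans (+-comm 1# x)
    [x+1][x-1]≡0 : (x + 1#) * (x + - 1#) ≡ 0#
    [x+1][x-1]≡0 = begin
      (x + 1#) * (x + - 1#)  ≡⟨ [x+y][x-y]≡xx-yy x 1# ⟩
      x * x + - (1# * 1#)    ≡⟨ cong₂ (λ a b → a + - b) xx≡1 (*-identityˡ 1#) ⟩
      1# + - 1#              ≡⟨ -‿inverseʳ 1# ⟩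
      0#                     ∎

  _⁻¹ : F → F
  x ⁻¹ with x ≟ 0#
  ... | yes _   = 0#
  ... | no x≢0  = proj₁ (inverse x≢0)

  x*x⁻¹≡1 : ∀ {x} → x ≢ 0# → x * x ⁻¹ ≡ 1#
  x*x⁻¹≡1 {x} x≢0 with x ≟ 0#
  ... | yes x≡0 = ⊥-elim (x≢0 x≡0)
  ... | no x≢0  = proj₂ (inverse x≢0)

  partner : F → F → F
  partner a y = a * y ⁻¹

  *-partner : ∀ a {y} → y ≢ 0# → y * partner a y ≡ a
  *-partner a {y} y≢0 = begin
    y * (a * y ⁻¹)  ≡⟨ x∙yz≈y∙xz y a (y ⁻¹) ⟩
    a * (y * y ⁻¹)  ≡⟨ cong (a *_) (x*x⁻¹≡1 y≢0) ⟩
    a * 1#          ≡⟨ *-identityʳ a ⟩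
    a               ∎
    where open ≡-Reasoning

  partner-unique : ∀ {a y w} → y ≢ 0# → y * w ≡ a → partner a y ≡ w
  partner-unique y≢0 yw≡a = *-cancelˡ y≢0 (trans (*-partner _ y≢0) (sym yw≡a))

  partner-≢0 : ∀ {a y} → a ≢ 0# → y ≢ 0# → partner a y ≢ 0#
  partner-≢0 {a} {y} a≢0 y≢0 a/y≡0 =
    a≢0 (trans (sym (*-partner a y≢0)) (trans (cong (y *_) a/y≡0) (zeroʳ y)))

  partner-involutive : ∀ {a y} → a ≢ 0# → y ≢ 0# → partner a (partner a y) ≡ y
  partner-involutive a≢0 y≢0 =
    partner-unique (partner-≢0 a≢0 y≢0) (trans (*-comm _ _) (*-partner _ y≢0))

  -- Inversion fixes exactly ±1, so it pairs up the other units.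
  Unit≢±1 : F → Set
  Unit≢±1 y = y ≢ 0# × y ≢ 1# × y ≢ - 1#

  1/y≡c⇒y≡c : ∀ {y c} → y ≢ 0# → c * c ≡ 1# → partner 1# y ≡ c → y ≡ c
  1/y≡c⇒y≡c {y} {c} y≢0 cc≡1 1/y≡c = begin
    y                          ≡⟨ sym (partner-involutive 1≢0 y≢0) ⟩
    partner 1# (partner 1# y)  ≡⟨ cong (partner 1#) 1/y≡c ⟩
    partner 1# c               ≡⟨ partner-unique (x*y≡1⇒y≢0 cc≡1) cc≡1 ⟩
    c                          ∎
    where open ≡-Reasoning

  1/y-Unit≢±1 : ∀ {y} → Unit≢±1 y → Unit≢±1 (partner 1# y)
  1/y-Unit≢±1 (y≢0 , y≢1 , y≢-1) =
    partner-≢0 1≢0 y≢0 , y≢1 ∘ 1/y≡c⇒y≡c y≢0 (*-identityˡ 1#) , y≢-1 ∘ 1/y≡c⇒y≡c y≢0 -1*-1≡1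

  1/y≢y : ∀ {y} → Unit≢±1 y → partner 1# y ≢ y
  1/y≢y (y≢0 , y≢1 , y≢-1) 1/y≡y =
    [ y≢1 , y≢-1 ]′ (x*x≡1⇒x≡1∨x≡-1 (trans (cong (_ *_) (sym 1/y≡y)) (*-partner 1# y≢0)))

  i*i≡-1⇒i≢0 : ∀ {i} → i * i ≡ - 1# → i ≢ 0#
  i*i≡-1⇒i≢0 {i} ii≡-1 refl = -1≢0 (trans (sym ii≡-1) (zeroˡ i))

  [iy]²≡-y² : ∀ {i} → i * i ≡ - 1# → ∀ y → (i * y) * (i * y) ≡ - (y * y)
  [iy]²≡-y² {i} ii≡-1 y = begin
    (i * y) * (i * y)  ≡⟨ interchange i y i y ⟩
    (i * i) * (y * y)  ≡⟨ cong (_* (y * y)) ii≡-1 ⟩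
    - 1# * (y * y)     ≡⟨ -1*x≈-x (y * y) ⟩
    - (y * y)          ∎
    where open ≡-Reasoning

  [1+x]²≡[1+x²]+2x : ∀ x → (1# + x) * (1# + x) ≡ (1# + x * x) + (x + x)
  [1+x]²≡[1+x²]+2x x = begin
    (1# + x) * (1# + x)             ≡⟨ distribʳ (1# + x) 1# x ⟩
    1# * (1# + x) + x * (1# + x)    ≡⟨ cong₂ _+_ (*-identityˡ (1# + x)) (distribˡ x 1# x) ⟩
    (1# + x) + (x * 1# + x * x)     ≡⟨ cong (λ a → (1# + x) + (a + x * x)) (*-identityʳ x) ⟩
    (1# + x) + (x + x * x)          ≡⟨ cong ((1# + x) +_) (+-comm x (x * x)) ⟩
    (1# + x) + (x * x + x)          ≡⟨ +-interchange 1# x (x * x) x ⟩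
    (1# + x * x) + (x + x)          ∎
    where open ≡-Reasoning

  1+q≡0⇒1-q≡2 : ∀ {q} → 1# + q ≡ 0# → 1# + - q ≡ 1# + 1#
  1+q≡0⇒1-q≡2 1+q≡0 = cong (1# +_) (trans (cong -_ (x+y≡0⇒y≡-x 1+q≡0)) (-‿involutive 1#))

  1-q≡0⇒1+q≡2 : ∀ {q} → 1# + - q ≡ 0# → 1# + q ≡ 1# + 1#
  1-q≡0⇒1+q≡2 1-q≡0 = cong (1# +_) (-‿injective (x+y≡0⇒y≡-x 1-q≡0))

  1-q²≡[1+q][1-q] : ∀ q → 1# + - (q * q) ≡ (1# + q) * (1# + - q)
  1-q²≡[1+q][1-q] q = begin
    1# + - (q * q)          ≡⟨ cong (λ a → a + - (q * q)) (sym (*-identityˡ 1#)) ⟩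
    1# * 1# + - (q * q)     ≡⟨ sym ([x+y][x-y]≡xx-yy 1# q) ⟩
    (1# + q) * (1# + - q)   ∎
    where open ≡-Reasoning

  -- On the ring of PrimeField p, NonzeroSquare and InT unfold to the definitions there.
  IsSquare : F → Set
  IsSquare a = ∃ λ y → y * y ≡ a

  NonzeroSquare : F → Set
  NonzeroSquare a = a ≢ 0# × IsSquare a

  InT : F → Set
  InT x = x ≢ 0# × NonzeroSquare (1# + x * x)

  InT-i* : ∀ {i y} → i * i ≡ - 1# → y ≢ 0# → NonzeroSquare (1# + - (y * y)) → InT (i * y)
  InT-i* {i} {y} ii≡-1 y≢0 sq =
    x≢0∧y≢0⇒x*y≢0 (i*i≡-1⇒i≢0 ii≡-1) y≢0 ,
    subst NonzeroSquare (cong (1# +_) (sym ([iy]²≡-y² ii≡-1 y))) sq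

  ∏ : List F → F
  ∏ = foldr _*_ 1#

  remove : F → List F → List F
  remove x = filter (λ y → ¬? (y ≟ x))

  ∈-remove⁺ : ∀ {x y L} → y ∈ L → y ≢ x → y ∈ remove x L
  ∈-remove⁺ {x} = ∈-filter⁺ (λ y → ¬? (y ≟ x))

  ∈-remove⁻ : ∀ {x y} L → y ∈ remove x L → y ∈ L × y ≢ x
  ∈-remove⁻ {x} L = ∈-filter⁻ (λ y → ¬? (y ≟ x)) {xs = L}

  remove-unique : ∀ x {L} → Unique L → Unique (remove x L)
  remove-unique x = filter⁺ (λ y → ¬? (y ≟ x))

  length-∏-remove : ∀ {x L} → Unique L → x ∈ L →
                    length L ≡ suc (length (remove x L)) × ∏ L ≡ x * ∏ (remove x L)
  length-∏-remove {L = y ∷ L} (y∉L ∷ _) (here refl)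
    rewrite filter-reject (λ z → ¬? (z ≟ y)) {y} {L} (λ y≢y → y≢y refl)
          | filter-all (λ z → ¬? (z ≟ y)) (All.map (λ y≢z z≡y → y≢z (sym z≡y)) y∉L)
          = refl , refl
  length-∏-remove {x} {y ∷ L} (y∉L ∷ L-unique) (there x∈L)
    rewrite filter-accept (λ z → ¬? (z ≟ x)) {y} {L} (All.lookup y∉L x∈L) =
      let |L|≡ , ∏L≡ = length-∏-remove L-unique x∈L
      in cong suc |L|≡ , trans (cong (y *_) ∏L≡) (x∙yz≈y∙xz y x _)

  module Pairing
    (a : F) (σ : F → F) (P : F → Set)
    (σ-involutive : ∀ {y} → P y → σ (σ y) ≡ y)
    (σ-fixpoint-free : ∀ {y} → P y → σ y ≢ y)
    (y*σy≡a : ∀ {y} → P y → y * σ y ≡ a)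
    where

    Closed : List F → Set
    Closed L = ∀ {y} → y ∈ L → σ y ∈ L

    PairsUp : List F → Set
    PairsUp L = ∃ λ m → length L ≡ 2 ℕ.* m × ∏ L ≡ a ^ m

    σ-head∈tail : ∀ {y L} → P y → Closed (y ∷ L) → σ y ∈ L
    σ-head∈tail Py closed with closed (here refl)
    ... | here σy≡y  = ⊥-elim (σ-fixpoint-free Py σy≡y)
    ... | there σy∈L = σy∈L

    remove-σ-head-closed : ∀ {y L} → All (y ≢_) L → (∀ {z} → z ∈ y ∷ L → P z) → Closed (y ∷ L) →
                           Closed (remove (σ y) L)
    remove-σ-head-closed {y} {L} y∉L ⊆P closed {z} z∈L′ = ∈-remove⁺ σz∈L σz≢σy
      where
      z∈L = proj₁ (∈-remove⁻ L z∈L′)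
      z≢σy = proj₂ (∈-remove⁻ L z∈L′)
      Py = ⊆P (here refl)
      Pz = ⊆P (there z∈L)
      σz∈L : σ z ∈ L
      σz∈L with closed (there z∈L)
      ... | here σz≡y  = ⊥-elim (z≢σy (trans (sym (σ-involutive Pz)) (cong σ σz≡y)))
      ... | there σz∈L = σz∈L
      σz≢σy : σ z ≢ σ y
      σz≢σy σz≡σy = All.lookup y∉L z∈L
        (trans (sym (σ-involutive Py)) (trans (cong σ (sym σz≡σy)) (σ-involutive Pz)))

    pairsUp-≤ : ∀ n L → length L ≤ n → Unique L → (∀ {y} → y ∈ L → P y) → Closed L → PairsUp L
    pairsUp-≤ _ [] _ _ _ _ = 0 , refl , refl
    pairsUp-≤ (suc n) (y ∷ L) (s≤s |L|≤n) (y∉L ∷ L-unique) ⊆P closed =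
      extend (pairsUp-≤ n L′ |L′|≤n (remove-unique (σ y) L-unique)
                (⊆P ∘ there ∘ proj₁ ∘ ∈-remove⁻ L) (remove-σ-head-closed y∉L ⊆P closed))
      where
      L′ = remove (σ y) L
      σy∈L = σ-head∈tail (⊆P (here refl)) closed
      |L|≡1+|L′| = proj₁ (length-∏-remove L-unique σy∈L)
      ∏L≡σy*∏L′ = proj₂ (length-∏-remove L-unique σy∈L)

      |L′|≤n : length L′ ≤ n
      |L′|≤n = ℕ.≤-trans (ℕ.n≤1+n _) (subst (_≤ n) |L|≡1+|L′| |L|≤n)

      extend : PairsUp L′ → PairsUp (y ∷ L)
      extend (m , |L′|≡2m , ∏L′≡aᵐ) = suc m , |y∷L|≡2[1+m] , (begin
        y * ∏ L           ≡⟨ cong (y *_) ∏L≡σy*∏L′ ⟩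
        y * (σ y * ∏ L′)  ≡⟨ sym (*-assoc y (σ y) (∏ L′)) ⟩
        y * σ y * ∏ L′    ≡⟨ cong₂ _*_ (y*σy≡a (⊆P (here refl))) ∏L′≡aᵐ ⟩
        a * a ^ m         ∎)
        where
        open ≡-Reasoning
        |y∷L|≡2[1+m] : suc (length L) ≡ 2 ℕ.* suc m
        |y∷L|≡2[1+m] = trans (cong suc (trans |L|≡1+|L′| (cong suc |L′|≡2m))) (sym (ℕ.*-suc 2 m))

    pairsUp : ∀ L → Unique L → (∀ {y} → y ∈ L → P y) → Closed L → PairsUp L
    pairsUp L = pairsUp-≤ (length L) L ℕ.≤-refl

  module Finite
    (elements : List F) (elements-unique : Unique elements) (∈-elements : ∀ x → x ∈ elements)
    where

    isSquare? : ∀ a → Dec (IsSquare a)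
    isSquare? a with Any.any? (λ y → (y * y) ≟ a) elements
    ... | yes sq = yes (Any.satisfied sq)
    ... | no ¬sq = no λ (y , yy≡a) → ¬sq (Any.map (λ { refl → yy≡a }) (∈-elements y))

    square-trichotomy : ∀ a → a ≡ 0# ⊎ NonzeroSquare a ⊎ (a ≢ 0# × ¬ IsSquare a)
    square-trichotomy a with a ≟ 0# | isSquare? a
    ... | yes a≡0 | _      = inj₁ a≡0
    ... | no a≢0  | yes sq = inj₂ (inj₁ (a≢0 , sq))
    ... | no a≢0  | no ¬sq = inj₂ (inj₂ (a≢0 , ¬sq))

    nonzero : List F
    nonzero = remove 0# elements

    nonzero-unique : Unique nonzero
    nonzero-unique = remove-unique 0# elements-unique

    ∈-nonzero⁺ : ∀ {y} → y ≢ 0# → y ∈ nonzero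
    ∈-nonzero⁺ {y} = ∈-remove⁺ (∈-elements y)

    ∈-nonzero⁻ : ∀ {y} → y ∈ nonzero → y ≢ 0#
    ∈-nonzero⁻ = proj₂ ∘ ∈-remove⁻ elements

    ∏-nonzero≡-1 : ∏ nonzero ≡ - 1#
    ∏-nonzero≡-1 = begin
      ∏ nonzero         ≡⟨ proj₂ (length-∏-remove nonzero-unique (∈-nonzero⁺ 1≢0)) ⟩
      1# * ∏ nonzero′   ≡⟨ *-identityˡ _ ⟩
      ∏ nonzero′        ≡⟨ proj₂ (length-∏-remove (remove-unique 1# nonzero-unique) -1∈nonzero′) ⟩
      - 1# * ∏ L        ≡⟨ cong (- 1# *_) ∏L≡1 ⟩
      - 1# * 1#         ≡⟨ *-identityʳ _ ⟩
      - 1#              ∎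
      where
      open ≡-Reasoning
      nonzero′ = remove 1# nonzero
      L = remove (- 1#) nonzero′

      -1∈nonzero′ : - 1# ∈ nonzero′
      -1∈nonzero′ = ∈-remove⁺ (∈-nonzero⁺ -1≢0) (1≢-1 ∘ sym)

      ∈L⁺ : ∀ {y} → Unit≢±1 y → y ∈ L
      ∈L⁺ (y≢0 , y≢1 , y≢-1) = ∈-remove⁺ (∈-remove⁺ (∈-nonzero⁺ y≢0) y≢1) y≢-1

      ∈L⁻ : ∀ {y} → y ∈ L → Unit≢±1 y
      ∈L⁻ y∈L =
        let y∈nonzero′ , y≢-1 = ∈-remove⁻ nonzero′ y∈L
            y∈nonzero , y≢1 = ∈-remove⁻ nonzero y∈nonzero′
        in ∈-nonzero⁻ y∈nonzero , y≢1 , y≢-1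

      ∏L≡1 : ∏ L ≡ 1#
      ∏L≡1 =
        let open Pairing 1# (partner 1#) Unit≢±1
                   (partner-involutive 1≢0 ∘ proj₁) 1/y≢y (*-partner 1# ∘ proj₁)
            m , _ , ∏L≡1ᵐ = pairsUp L (remove-unique (- 1#) (remove-unique 1# nonzero-unique))
                                    ∈L⁻ (∈L⁺ ∘ 1/y-Unit≢±1 ∘ ∈L⁻)
        in trans ∏L≡1ᵐ (1#^n≡1 m)

    module OddOrder (h : ℕ) (|elements|≡1+2h : length elements ≡ suc (2 ℕ.* h)) where

      euler-criterion : ∀ {a} → a ≢ 0# → ¬ IsSquare a → a ^ h ≡ - 1#
      euler-criterion {a} a≢0 ¬sq =
        conclude (pairsUp nonzero nonzero-unique ∈-nonzero⁻ (∈-nonzero⁺ ∘ partner-≢0 a≢0 ∘ ∈-nonzero⁻))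
        where
        a/y≢y : ∀ {y} → y ≢ 0# → partner a y ≢ y
        a/y≢y y≢0 a/y≡y = ¬sq (_ , trans (cong (_ *_) (sym a/y≡y)) (*-partner a y≢0))

        open Pairing a (partner a) (_≢ 0#) (partner-involutive a≢0) a/y≢y (*-partner a)

        |nonzero|≡2h : length nonzero ≡ 2 ℕ.* h
        |nonzero|≡2h = suc-injective
          (trans (sym (proj₁ (length-∏-remove elements-unique (∈-elements 0#)))) |elements|≡1+2h)

        conclude : PairsUp nonzero → a ^ h ≡ - 1#
        conclude (m , |nonzero|≡2m , ∏nonzero≡aᵐ) = begin
          a ^ h       ≡⟨ cong (a ^_) (ℕ.*-cancelˡ-≡ h m 2 (trans (sym |nonzero|≡2h) |nonzero|≡2m)) ⟩
          a ^ m       ≡⟨ sym ∏nonzero≡aᵐ ⟩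
          ∏ nonzero   ≡⟨ ∏-nonzero≡-1 ⟩
          - 1#        ∎
          where open ≡-Reasoning

      nonsquare*nonsquare : ∀ {a b} → a ≢ 0# → ¬ IsSquare a → b ≢ 0# → ¬ IsSquare b → IsSquare (a * b)
      nonsquare*nonsquare {a} {b} a≢0 ¬sq-a b≢0 ¬sq-b with isSquare? (a * b)
      ... | yes sq = sq
      ... | no ¬sq = ⊥-elim (1≢-1 (begin
        1#            ≡⟨ sym -1*-1≡1 ⟩
        - 1# * - 1#   ≡⟨ sym (cong₂ _*_ (euler-criterion a≢0 ¬sq-a) (euler-criterion b≢0 ¬sq-b)) ⟩
        a ^ h * b ^ h ≡⟨ sym (^-distrib-* a b h) ⟩
        (a * b) ^ h   ≡⟨ euler-criterion (x≢0∧y≢0⇒x*y≢0 a≢0 b≢0) ¬sq ⟩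
        - 1#          ∎))
        where open ≡-Reasoning

      isSquare-√-1 : 4 ∣ h → ∀ {i} → i * i ≡ - 1# → IsSquare i
      isSquare-√-1 (divides k h≡k*4) {i} ii≡-1 with isSquare? i
      ... | yes sq = sq
      ... | no ¬sq = ⊥-elim (1≢-1 (begin
        1#            ≡⟨ sym (1#^n≡1 k) ⟩
        1# ^ k        ≡⟨ cong (_^ k) i^4≡1 ⟨
        (i ^ 4) ^ k   ≡⟨ ^-assocʳ i 4 k ⟩
        i ^ (4 ℕ.* k) ≡⟨ cong (i ^_) (trans (ℕ.*-comm 4 k) (sym h≡k*4)) ⟩
        i ^ h         ≡⟨ euler-criterion (i*i≡-1⇒i≢0 ii≡-1) ¬sq ⟩
        - 1#          ∎))
        where
        open ≡-Reasoning
        i^2≡-1 : i ^ 2 ≡ - 1#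
        i^2≡-1 = trans (cong (i *_) (*-identityʳ i)) ii≡-1
        i^4≡1 : i ^ 4 ≡ 1#
        i^4≡1 = trans (^-homo-* i 2 2) (trans (cong₂ _*_ i^2≡-1 i^2≡-1) -1*-1≡1)

      2-isNonzeroSquare : 4 ∣ h → ∀ {i} → i * i ≡ - 1# → NonzeroSquare (1# + 1#)
      2-isNonzeroSquare 4∣h {i} ii≡-1 = 1≢-1 ∘ x+y≡0⇒y≡-x , i * c * (1# + i) , (begin
        (i * c * (1# + i)) * (i * c * (1# + i))      ≡⟨ interchange (i * c) (1# + i) (i * c) (1# + i) ⟩
        ((i * c) * (i * c)) * ((1# + i) * (1# + i))  ≡⟨ cong₂ _*_ [ic]²≡-i [1+i]²≡2i ⟩
        - i * (i + i)                                ≡⟨ distribˡ (- i) i i ⟩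
        - i * i + - i * i                            ≡⟨ cong₂ _+_ -i*i≡1 -i*i≡1 ⟩
        1# + 1#                                      ∎)
        where
        open ≡-Reasoning
        c = proj₁ (isSquare-√-1 4∣h ii≡-1)
        cc≡i = proj₂ (isSquare-√-1 4∣h ii≡-1)
        [ic]²≡-i : (i * c) * (i * c) ≡ - i
        [ic]²≡-i = trans ([iy]²≡-y² ii≡-1 c) (cong -_ cc≡i)
        [1+i]²≡2i : (1# + i) * (1# + i) ≡ i + i
        [1+i]²≡2i = begin
          (1# + i) * (1# + i)     ≡⟨ [1+x]²≡[1+x²]+2x i ⟩
          (1# + i * i) + (i + i)  ≡⟨ cong (λ a → (1# + a) + (i + i)) ii≡-1 ⟩
          (1# + - 1#) + (i + i)   ≡⟨ cong (_+ (i + i)) (-‿inverseʳ 1#) ⟩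
          0# + (i + i)            ≡⟨ +-identityˡ (i + i) ⟩
          i + i                   ∎
        -i*i≡1 : - i * i ≡ 1#
        -i*i≡1 = trans (sym (-‿distribˡ-* i i)) (trans (cong -_ ii≡-1) (-‿involutive 1#))

      InT-x∨ix∨ix² : 4 ∣ h → ∀ i → i * i ≡ - 1# → ∀ x → x ≢ 0# →
                     InT x ⊎ InT (i * x) ⊎ InT (i * (x * x))
      InT-x∨ix∨ix² 4∣h i ii≡-1 x x≢0
        with square-trichotomy (1# + x * x) | square-trichotomy (1# + - (x * x))
      ... | inj₂ (inj₁ sq) | _ = inj₁ (x≢0 , sq)
      ... | _ | inj₂ (inj₁ sq) = inj₂ (inj₁ (InT-i* ii≡-1 x≢0 sq))
      ... | inj₁ 1+x²≡0 | _ = inj₂ (inj₁ (InT-i* ii≡-1 x≢0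
        (subst NonzeroSquare (sym (1+q≡0⇒1-q≡2 1+x²≡0)) (2-isNonzeroSquare 4∣h ii≡-1))))
      ... | _ | inj₁ 1-x²≡0 = inj₁ (x≢0 ,
        subst NonzeroSquare (sym (1-q≡0⇒1+q≡2 1-x²≡0)) (2-isNonzeroSquare 4∣h ii≡-1))
      ... | inj₂ (inj₂ (u≢0 , ¬sq-u)) | inj₂ (inj₂ (v≢0 , ¬sq-v)) =
        inj₂ (inj₂ (InT-i* ii≡-1 (x≢0∧y≢0⇒x*y≢0 x≢0 x≢0)
          (subst NonzeroSquare (sym (1-q²≡[1+q][1-q] (x * x)))
            (x≢0∧y≢0⇒x*y≢0 u≢0 v≢0 , nonsquare*nonsquare u≢0 ¬sq-u v≢0 ¬sq-v))))

module PrimeFieldProperties (p : ℕ) .{{_ : NonZero p}} where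
  open PrimeField p

  -- Each operation of PrimeField reduces the ℕ-operation on representatives modulo p,
  -- so []-+ and []-* transport every ring law from ℕ.
  [_] : ℕ → F
  [ m ] = m mod p

  toℕ-[] : ∀ m → toℕ [ m ] ≡ m % p
  toℕ-[] m = toℕ-fromℕ< _

  %-≡⇒[]-≡ : ∀ {m n} → m % p ≡ n % p → [ m ] ≡ [ n ]
  %-≡⇒[]-≡ {m} {n} eq = toℕ-injective (trans (toℕ-[] m) (trans eq (sym (toℕ-[] n))))

  []-toℕ : ∀ a → [ toℕ a ] ≡ a
  []-toℕ a = toℕ-injective (trans (toℕ-[] (toℕ a)) (m<n⇒m%n≡m (toℕ<n a)))

  []-+ : ∀ m n → [ m ℕ.+ n ] ≡ [ m ] +F [ n ]
  []-+ m n = %-≡⇒[]-≡ (trans (%-distribˡ-+ m n p)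
    (sym (cong₂ (λ a b → (a ℕ.+ b) % p) (toℕ-[] m) (toℕ-[] n))))

  []-* : ∀ m n → [ m ℕ.* n ] ≡ [ m ] *F [ n ]
  []-* m n = %-≡⇒[]-≡ (trans (%-distribˡ-* m n p)
    (sym (cong₂ (λ a b → (a ℕ.* b) % p) (toℕ-[] m) (toℕ-[] n))))

  [m+kp]≡[m] : ∀ m k → [ m ℕ.+ k ℕ.* p ] ≡ [ m ]
  [m+kp]≡[m] m k = %-≡⇒[]-≡ ([m+kn]%n≡m%n m k p)

  +F-assoc : ∀ a b c → (a +F b) +F c ≡ a +F (b +F c)
  +F-assoc a b c = begin
    (a +F b) +F c                                   ≡⟨ cong ((a +F b) +F_) ([]-toℕ c) ⟨
    [ toℕ a ℕ.+ toℕ b ] +F [ toℕ c ]                ≡⟨ []-+ (toℕ a ℕ.+ toℕ b) (toℕ c) ⟨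
    [ toℕ a ℕ.+ toℕ b ℕ.+ toℕ c ]                   ≡⟨ cong [_] (ℕ.+-assoc (toℕ a) (toℕ b) (toℕ c)) ⟩
    [ toℕ a ℕ.+ (toℕ b ℕ.+ toℕ c) ]                 ≡⟨ []-+ (toℕ a) (toℕ b ℕ.+ toℕ c) ⟩
    [ toℕ a ] +F (b +F c)                           ≡⟨ cong (_+F (b +F c)) ([]-toℕ a) ⟩
    a +F (b +F c)                                   ∎
    where open ≡-Reasoning

  *F-assoc : ∀ a b c → (a *F b) *F c ≡ a *F (b *F c)
  *F-assoc a b c = begin
    (a *F b) *F c                                   ≡⟨ cong ((a *F b) *F_) ([]-toℕ c) ⟨
    [ toℕ a ℕ.* toℕ b ] *F [ toℕ c ]                ≡⟨ []-* (toℕ a ℕ.* toℕ b) (toℕ c) ⟨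
    [ toℕ a ℕ.* toℕ b ℕ.* toℕ c ]                   ≡⟨ cong [_] (ℕ.*-assoc (toℕ a) (toℕ b) (toℕ c)) ⟩
    [ toℕ a ℕ.* (toℕ b ℕ.* toℕ c) ]                 ≡⟨ []-* (toℕ a) (toℕ b ℕ.* toℕ c) ⟩
    [ toℕ a ] *F (b *F c)                           ≡⟨ cong (_*F (b *F c)) ([]-toℕ a) ⟩
    a *F (b *F c)                                   ∎
    where open ≡-Reasoning

  +F-comm : ∀ a b → a +F b ≡ b +F a
  +F-comm a b = cong [_] (ℕ.+-comm (toℕ a) (toℕ b))

  *F-comm : ∀ a b → a *F b ≡ b *F a
  *F-comm a b = cong [_] (ℕ.*-comm (toℕ a) (toℕ b))

  +F-identityˡ : ∀ a → 0F +F a ≡ a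
  +F-identityˡ a = begin
    [ 0 ] +F a         ≡⟨ cong ([ 0 ] +F_) ([]-toℕ a) ⟨
    [ 0 ] +F [ toℕ a ] ≡⟨ []-+ 0 (toℕ a) ⟨
    [ toℕ a ]          ≡⟨ []-toℕ a ⟩
    a                  ∎
    where open ≡-Reasoning

  *F-identityˡ : ∀ a → 1F *F a ≡ a
  *F-identityˡ a = begin
    [ 1 ] *F a         ≡⟨ cong ([ 1 ] *F_) ([]-toℕ a) ⟨
    [ 1 ] *F [ toℕ a ] ≡⟨ []-* 1 (toℕ a) ⟨
    [ 1 ℕ.* toℕ a ]    ≡⟨ cong [_] (ℕ.*-identityˡ (toℕ a)) ⟩
    [ toℕ a ]          ≡⟨ []-toℕ a ⟩
    a                  ∎
    where open ≡-Reasoning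

  -F-inverseˡ : ∀ a → (-F a) +F a ≡ 0F
  -F-inverseˡ a = begin
    [ p ∸ toℕ a ] +F a           ≡⟨ cong ([ p ∸ toℕ a ] +F_) ([]-toℕ a) ⟨
    [ p ∸ toℕ a ] +F [ toℕ a ]   ≡⟨ []-+ (p ∸ toℕ a) (toℕ a) ⟨
    [ p ∸ toℕ a ℕ.+ toℕ a ]      ≡⟨ cong [_] (ℕ.m∸n+n≡m (ℕ.<⇒≤ (toℕ<n a))) ⟩
    [ p ]                        ≡⟨ %-≡⇒[]-≡ ([m+n]%n≡m%n 0 p) ⟩
    [ 0 ]                        ∎
    where open ≡-Reasoning

  *F-distribˡ-+F : ∀ a b c → a *F (b +F c) ≡ (a *F b) +F (a *F c)
  *F-distribˡ-+F a b c = begin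
    a *F (b +F c)                                   ≡⟨ cong (_*F (b +F c)) ([]-toℕ a) ⟨
    [ toℕ a ] *F [ toℕ b ℕ.+ toℕ c ]                ≡⟨ []-* (toℕ a) (toℕ b ℕ.+ toℕ c) ⟨
    [ toℕ a ℕ.* (toℕ b ℕ.+ toℕ c) ]                 ≡⟨ cong [_] (ℕ.*-distribˡ-+ (toℕ a) (toℕ b) (toℕ c)) ⟩
    [ toℕ a ℕ.* toℕ b ℕ.+ toℕ a ℕ.* toℕ c ]         ≡⟨ []-+ (toℕ a ℕ.* toℕ b) (toℕ a ℕ.* toℕ c) ⟩
    (a *F b) +F (a *F c)                            ∎
    where open ≡-Reasoning

  isCommutativeRing : IsCommutativeRing _≡_ _+F_ _*F_ -F_ 0F 1F
  isCommutativeRing = record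
    { isRing = record
      { +-isAbelianGroup = record
        { isGroup = record
          { isMonoid = record
            { isSemigroup = record
              { isMagma = record { isEquivalence = isEquivalence ; ∙-cong = cong₂ _+F_ }
              ; assoc = +F-assoc }
            ; identity = +F-identityˡ , λ a → trans (+F-comm a 0F) (+F-identityˡ a) }
          ; inverse = -F-inverseˡ , λ a → trans (+F-comm a (-F a)) (-F-inverseˡ a)
          ; ⁻¹-cong = cong -F_ }
        ; comm = +F-comm }
      ; *-cong = cong₂ _*F_
      ; *-assoc = *F-assoc
      ; *-identity = *F-identityˡ , λ a → trans (*F-comm a 1F) (*F-identityˡ a)
      ; distrib = *F-distribˡ-+F , λ a b c →
          trans (*F-comm (b +F c) a) (trans (*F-distribˡ-+F a b c) (cong₂ _+F_ (*F-comm a b) (*F-comm a c))) }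
    ; *-comm = *F-comm }

  private
    commutativeRing : CommutativeRing _ _
    commutativeRing = record { isCommutativeRing = isCommutativeRing }

  open import Algebra.Properties.Ring (CommutativeRing.ring commutativeRing)
    using (-‿distribʳ-*; +-inverseʳ-unique; -‿involutive)

  *F-[] : ∀ a n → a *F [ n ] ≡ [ toℕ a ℕ.* n ]
  *F-[] a n = trans (cong (_*F [ n ]) (sym ([]-toℕ a))) (sym ([]-* (toℕ a) n))

  1F≢-1F : 2 ℕ.< p → 1F ≢ -F 1F
  1F≢-1F 2<p 1≡-1 = ℕ.0≢1+n (begin
    0            ≡⟨ m<n⇒m%n≡m (ℕ.>-nonZero⁻¹ p) ⟨
    0 % p        ≡⟨ toℕ-[] 0 ⟨
    toℕ [ 0 ]    ≡⟨ cong toℕ [2]≡[0] ⟨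
    toℕ [ 2 ]    ≡⟨ toℕ-[] 2 ⟩
    2 % p        ≡⟨ m<n⇒m%n≡m 2<p ⟩
    2            ∎)
    where
    open ≡-Reasoning
    [2]≡[0] : [ 2 ] ≡ [ 0 ]
    [2]≡[0] = trans ([]-+ 1 1) (trans (cong (_+F 1F) 1≡-1) (-F-inverseˡ 1F))

  inverse : Prime p → ∀ {a} → a ≢ 0F → ∃ λ y → a *F y ≡ 1F
  inverse p-prime {a} a≢0 with coprime-Bézout (prime⇒coprime p-prime {{ℕ.≢-nonZero toℕa≢0}} (toℕ<n a))
    where
    toℕa≢0 : toℕ a ≢ 0
    toℕa≢0 toℕa≡0 = a≢0 (trans (sym ([]-toℕ a)) (cong [_] toℕa≡0))
  ... | Bézout.-+ x y 1+xp≡ya = [ y ] , (begin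
    a *F [ y ]            ≡⟨ *F-[] a y ⟩
    [ toℕ a ℕ.* y ]       ≡⟨ cong [_] (trans (ℕ.*-comm (toℕ a) y) (sym 1+xp≡ya)) ⟩
    [ 1 ℕ.+ x ℕ.* p ]     ≡⟨ [m+kp]≡[m] 1 x ⟩
    [ 1 ]                 ∎)
    where open ≡-Reasoning
  ... | Bézout.+- x y 1+ya≡xp = -F [ y ] , (begin
    a *F (-F [ y ])       ≡⟨ -‿distribʳ-* a [ y ] ⟨
    -F (a *F [ y ])       ≡⟨ cong -F_ (+-inverseʳ-unique 1F (a *F [ y ]) 1+ay≡0) ⟩
    -F (-F 1F)            ≡⟨ -‿involutive 1F ⟩
    1F                    ∎)
    where
    open ≡-Reasoning
    1+ay≡0 : 1F +F (a *F [ y ]) ≡ 0F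
    1+ay≡0 = begin
      [ 1 ] +F (a *F [ y ])     ≡⟨ cong ([ 1 ] +F_) (*F-[] a y) ⟩
      [ 1 ] +F [ toℕ a ℕ.* y ]  ≡⟨ []-+ 1 (toℕ a ℕ.* y) ⟨
      [ 1 ℕ.+ toℕ a ℕ.* y ]     ≡⟨ cong (λ n → [ 1 ℕ.+ n ]) (ℕ.*-comm (toℕ a) y) ⟩
      [ 1 ℕ.+ y ℕ.* toℕ a ]     ≡⟨ cong [_] 1+ya≡xp ⟩
      [ 0 ℕ.+ x ℕ.* p ]         ≡⟨ [m+kp]≡[m] 0 x ⟩
      [ 0 ]                     ∎

proposition2p8 : (p : ℕ) .{{_ : NonZero p}} → Prime p → p % 8 ≡ 1 →
    let open PrimeField p in
    (i : F) → i *F i ≡ -F 1F →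
    (x : F) → x ≢ 0F →
    InT x ⊎ InT (i *F x) ⊎ InT (i *F (x *F x))
proposition2p8 p p-prime p%8≡1 = InT-x∨ix∨ix² (divides k (ℕ.*-comm 4 k))
  where
  open PrimeFieldProperties p
  k = p / 8

  p≡1+2[4k] : p ≡ suc (2 ℕ.* (4 ℕ.* k))
  p≡1+2[4k] = begin
    p                      ≡⟨ m≡m%n+[m/n]*n p 8 ⟩
    p % 8 ℕ.+ k ℕ.* 8      ≡⟨ cong (ℕ._+ k ℕ.* 8) p%8≡1 ⟩
    suc (k ℕ.* 8)          ≡⟨ cong suc (trans (ℕ.*-comm k 8) (ℕ.*-assoc 2 4 k)) ⟩
    suc (2 ℕ.* (4 ℕ.* k))  ∎
    where open ≡-Reasoning

  2<p : 2 ℕ.< p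
  2<p = ℕ.≤∧≢⇒< (ℕ.nonTrivial⇒n>1 p {{prime⇒nonTrivial p-prime}})
                (λ 2≡p → case subst (λ n → n % 8 ≡ 1) (sym 2≡p) p%8≡1 of λ ())

  open Field isCommutativeRing Fin._≟_ (inverse p-prime) (1F≢-1F 2<p)
  open Finite (allFin p) (allFin⁺ p) ∈-allFin
  open OddOrder (4 ℕ.* k) (trans (length-tabulate id) p≡1+2[4k])
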